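{- (Soundness of the tableau system $\mathsf{TC}_{\mathsf{SCI}}$.) For every $\mathsf{SCI}$-formula $\varphi$: if $\varphi$ is satisfiable, then $\varphi$ is tableau-satisfiable, i.e., there exists an open and fully expanded $\mathsf{TC}_{\mathsf{SCI}}$-tableau whose root is $w^+:\varphi$ for some $w^+\in\mathsf{L}^+$.
   Context: Logic SCI. Fix a countably infinite set $\mathsf{AF}$ of atomic formulas. The set $\mathsf{FOR}$ of SCI-formulas is given by $\varphi ::= p \mid \neg\varphi \mid \varphi\to\varphi \mid \varphi\equiv\varphi$ with $p\in\mathsf{AF}$. An SCI-model is a structure $\mathcal{M}=\langle U,D,\tilde\neg,\tilde\to,\tilde\equiv\rangle$ where $U\neq\emptyset$, $D\subseteq U$, $\tilde\neg:U\to U$, $\tilde\to,\tilde\equiv:U\times U\to U$, such that for all $a,b\in U$: $\tilde\neg a\in D$ iff $a\notin D$; $a\tilde\to b\in D$ iff $a\notin D$ or $b\in D$; $a\tilde\equiv b\in D$ iff $a=b$. A valuation in $\mathcal{M}$ is a map $V:\mathsf{FOR}\to U$ with $V(\neg\varphi)=\tilde\neg V(\varphi)$, $V(\varphi\to\psi)=V(\varphi)\tilde\to V(\psi)$, $V(\varphi\equiv\psi)=V(\varphi)\tilde\equiv V(\psi)$. A formula $\varphi$ is satisfied by $\mathcal{M},V$ if $V(\varphi)\in D$; satisfiable if it is satisfied in some SCI-model by some valuation; valid if satisfied in every SCI-model by every valuation. Tableau system $\mathsf{TC}_{\mathsf{SCI}}$. Let $\mathsf{L}^+,\mathsf{L}^-$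 be disjoint countably infinite sets of labels, $\mathsf{L}=\mathsf{L}^+\cup\mathsf{L}^-$; a label written $w^+$ lies in $\mathsf{L}^+$, $w^-$ in $\mathsf{L}^-$, an unsuperscripted label is arbitrary. A labelled formula is $w:\varphi$ with $w\in\mathsf{L},\varphi\in\mathsf{FOR}$. Equality statements $w=v$ and inequality statements $w\neq v$ ($w,v\in\mathsf{L}$) may also occur. A tableau is a tree whose nodes carry labelled formulas, (in)equality statements or $\bot$; a branch is a root-to-leaf path, identified with the set of items on it. Rules (premises / alternative conclusion sets separated by $\mid$): Decomposition rules (all labels in the conclusions are fresh, i.e. do not yet occur on the branch): $(\neg^+)$ $w^+:\neg\varphi$ / $v^-:\varphi$; $(\neg^-)$ $w^-:\neg\varphi$ / $v^+:\varphi$; $(\to^+)$ $w^+:\varphi\to\psi$ / $\{v^-:\varphi,u^-:\psi\}\mid\{v^-:\varphi,u^+:\psi\}\mid\{v^+:\varphi,u^+:\psi\}$; $(\to^-)$ $w^-:\varphi\to\psi$ / $\{v^+:\varphi,u^-:\psi\}$; $(\equiv^+)$ $w^+:\varphi\equiv\psi$ / $\{v^+:\varphi,u^+:\psi,v^+=u^+\}\mid\{v^-:\varphi,u^-:\psi,v^-=u^-\}$; $(\equiv^-)$ $w^-:\varphi\equiv\psi$ / $\{v^+:\varphi,u^+:\psi,v^+\neq u^+\}\mid\{v^+:\varphi,u^-:\psi\}\mid\{v^-:\varphi,u^+:\psi\}\mid\{v^-:\varphi,u^-:\psi,v^-\neq u^-\}$. Equality rules, where $\varphi\approx\psi$ abbreviates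 the three premises $w:\varphi$, $v:\psi$, $w=v$ for some labels $w,v$: $(\equiv^\neg)$ $\varphi\approx\psi$, $u:\neg\varphi$, $y:\neg\psi$ / $u=y$; $(\equiv^\to)$ $\varphi\approx\psi$, $\chi\approx\theta$, $x:\varphi\to\chi$, $z:\psi\to\theta$ / $x=z$; $(\equiv^\equiv)$ $\varphi\approx\psi$, $\chi\approx\theta$, $x:\varphi\equiv\chi$, $z:\psi\equiv\theta$ / $x=z$; $(\mathsf F)$ $w:\varphi$, $v:\varphi$ / $w=v$; $(\mathsf{sym})$ $w=v$ / $v=w$; $(\mathsf{tran})$ $w=v$, $v=u$ / $w=u$. Closure rules: $(\bot_1)$ $w=v$, $w\neq v$ / $\bot$; $(\bot_2)$ $w^+=v^-$ / $\bot$. A branch is extended by applying a rule to items on it, each alternative conclusion set giving a new branch. A decomposition rule may be applied to $w:\varphi$ on a branch only if it has not been applied to $w:\varphi$ on that branch before; an equality rule may be applied to premises on a branch only if its conclusion is not already on the branch. Closure rules are applied eagerly. A branch is closed if a closure rule has been applied on it, open otherwise; fully expanded if it is closed or no rule is applicable on it. A tableau is closed if all its branches are closed, open otherwise, and fully expanded if all its branches are. A formula $\varphi$ is tableau-satisfiable if there is an open, fully expanded tableau with $w^+:\varphi$ at its root. -}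

module Defs where

open import Data.Nat using (ℕ)
open import Data.List using (List; []; _∷_; [_]; _++_)
open import Data.List.Membership.Propositional using (_∈_; _∉_)
open import Data.List.Relation.Unary.Any using (Any)
open import Data.Product using (Σ; _×_; _,_; ∃; ∃-syntax)
open import Data.Sum using (_⊎_)
open import Data.Empty using (⊥)
open import Relation.Nullary using (¬_)
open import Relation.Binary.PropositionalEquality using (_≡_; _≢_)
open import Relation.Unary using (Pred)
open import Level using (0ℓ)

infixr 6 _⇒_
infix  7 _≣_
data Formula : Set where
  atom : ℕ → Formula
  ~_   : Formula → Formula
  _⇒_  : Formula → Formula → Formula
  _≣_  : Formula → Formula → Formula

record SCIModel : Set₁ where
  field
    U    : Set
    D    : Pred U 0ℓ
    neg  : U → U
    imp  : U → U → U
    eqv  : U → U → U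
    neg-D : ∀ a → (D (neg a) → ¬ D a) × (¬ D a → D (neg a))
    imp-D : ∀ a b → (D (imp a b) → (¬ D a ⊎ D b)) × ((¬ D a ⊎ D b) → D (imp a b))
    eqv-D : ∀ a b → (D (eqv a b) → a ≡ b) × (a ≡ b → D (eqv a b))

record Valuation (M : SCIModel) : Set where
  open SCIModel M
  field
    V     : Formula → U
    V-neg : ∀ φ → V (~ φ) ≡ neg (V φ)
    V-imp : ∀ φ ψ → V (φ ⇒ ψ) ≡ imp (V φ) (V ψ)
    V-eqv : ∀ φ ψ → V (φ ≣ ψ) ≡ eqv (V φ) (V ψ)

Satisfiable : Formula → Set₁
Satisfiable φ = Σ SCIModel λ M → Σ (Valuation M) λ v →
  SCIModel.D M (Valuation.V v φ)

-- Labels: L⁺ = {plus n}, L⁻ = {minus n}, disjoint and countably infinite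

data Sign : Set where
  pos negv : Sign

record Label : Set where
  constructor lab
  field
    sign : Sign
    idx  : ℕ

plus minus : ℕ → Label
plus n  = lab pos n
minus n = lab negv n

data Item : Set where
  _∶_  : Label → Formula → Item
  _≐_  : Label → Label → Item
  _≠_  : Label → Label → Item
  bot  : Item

Occurs : Label → Item → Set
Occurs x (w ∶ φ) = x ≡ w
Occurs x (w ≐ v) = x ≡ w ⊎ x ≡ v
Occurs x (w ≠ v) = x ≡ w ⊎ x ≡ v
Occurs x bot     = ⊥

-- The state of a branch: the items on it, and the labelled formulas to
-- which a decomposition rule has already been applied on it.
record State : Set where
  constructor st
  field
    items : List Item
    used  : List (Label × Formula)
open State public

Fresh : State → Label → Set
Fresh s x = ¬ Any (Occurs x) (items s)

FreshPair : State → Label → Label → Set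
FreshPair s v u = Fresh s v × Fresh s u × v ≢ u

ext : State → Label → Formula → List Item → State
ext s w φ cs = st (cs ++ items s) ((w , φ) ∷ used s)

add : Item → State → State
add c s = st (c ∷ items s) (used s)

data Decomp (s : State) : List State → Set where
  d¬⁺ : ∀ {n φ v} → (plus n ∶ (~ φ)) ∈ items s → (plus n , ~ φ) ∉ used s →
        Fresh s (minus v) →
        Decomp s [ ext s (plus n) (~ φ) [ minus v ∶ φ ] ]
  d¬⁻ : ∀ {n φ v} → (minus n ∶ (~ φ)) ∈ items s → (minus n , ~ φ) ∉ used s →
        Fresh s (plus v) →
        Decomp s [ ext s (minus n) (~ φ) [ plus v ∶ φ ] ]
  d⇒⁺ : ∀ {n φ ψ v₁ u₁ v₂ u₂ v₃ u₃} →
        (plus n ∶ (φ ⇒ ψ)) ∈ items s → (plus n , φ ⇒ ψ) ∉ used s →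
        FreshPair s (minus v₁) (minus u₁) →
        FreshPair s (minus v₂) (plus u₂) →
        FreshPair s (plus v₃) (plus u₃) →
        Decomp s ( ext s (plus n) (φ ⇒ ψ) (minus v₁ ∶ φ ∷ minus u₁ ∶ ψ ∷ [])
                 ∷ ext s (plus n) (φ ⇒ ψ) (minus v₂ ∶ φ ∷ plus u₂ ∶ ψ ∷ [])
                 ∷ ext s (plus n) (φ ⇒ ψ) (plus v₃ ∶ φ ∷ plus u₃ ∶ ψ ∷ [])
                 ∷ [])
  d⇒⁻ : ∀ {n φ ψ v u} →
        (minus n ∶ (φ ⇒ ψ)) ∈ items s → (minus n , φ ⇒ ψ) ∉ used s →
        FreshPair s (plus v) (minus u) →
        Decomp s [ ext s (minus n) (φ ⇒ ψ) (plus v ∶ φ ∷ minus u ∶ ψ ∷ []) ]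
  d≣⁺ : ∀ {n φ ψ v₁ u₁ v₂ u₂} →
        (plus n ∶ (φ ≣ ψ)) ∈ items s → (plus n , φ ≣ ψ) ∉ used s →
        FreshPair s (plus v₁) (plus u₁) →
        FreshPair s (minus v₂) (minus u₂) →
        Decomp s ( ext s (plus n) (φ ≣ ψ) (plus v₁ ∶ φ ∷ plus u₁ ∶ ψ ∷ plus v₁ ≐ plus u₁ ∷ [])
                 ∷ ext s (plus n) (φ ≣ ψ) (minus v₂ ∶ φ ∷ minus u₂ ∶ ψ ∷ minus v₂ ≐ minus u₂ ∷ [])
                 ∷ [])
  d≣⁻ : ∀ {n φ ψ v₁ u₁ v₂ u₂ v₃ u₃ v₄ u₄} →
        (minus n ∶ (φ ≣ ψ)) ∈ items s → (minus n , φ ≣ ψ) ∉ used s →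
        FreshPair s (plus v₁) (plus u₁) →
        FreshPair s (plus v₂) (minus u₂) →
        FreshPair s (minus v₃) (plus u₃) →
        FreshPair s (minus v₄) (minus u₄) →
        Decomp s ( ext s (minus n) (φ ≣ ψ) (plus v₁ ∶ φ ∷ plus u₁ ∶ ψ ∷ plus v₁ ≠ plus u₁ ∷ [])
                 ∷ ext s (minus n) (φ ≣ ψ) (plus v₂ ∶ φ ∷ minus u₂ ∶ ψ ∷ [])
                 ∷ ext s (minus n) (φ ≣ ψ) (minus v₃ ∶ φ ∷ plus u₃ ∶ ψ ∷ [])
                 ∷ ext s (minus n) (φ ≣ ψ) (minus v₄ ∶ φ ∷ minus u₄ ∶ ψ ∷ minus v₄ ≠ minus u₄ ∷ [])
                 ∷ [])

Approx : State → Formula → Formula → Set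
Approx s φ ψ = ∃[ w ] ∃[ v ] ((w ∶ φ) ∈ items s × (v ∶ ψ) ∈ items s × (w ≐ v) ∈ items s)

data EqRule (s : State) : Item → Set where
  e¬   : ∀ {φ ψ u y} → Approx s φ ψ → (u ∶ (~ φ)) ∈ items s → (y ∶ (~ ψ)) ∈ items s →
         EqRule s (u ≐ y)
  e⇒   : ∀ {φ ψ χ θ x z} → Approx s φ ψ → Approx s χ θ →
         (x ∶ (φ ⇒ χ)) ∈ items s → (z ∶ (ψ ⇒ θ)) ∈ items s → EqRule s (x ≐ z)
  e≣   : ∀ {φ ψ χ θ x z} → Approx s φ ψ → Approx s χ θ →
         (x ∶ (φ ≣ χ)) ∈ items s → (z ∶ (ψ ≣ θ)) ∈ items s → EqRule s (x ≐ z)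
  eF   : ∀ {φ w v} → (w ∶ φ) ∈ items s → (v ∶ φ) ∈ items s → EqRule s (w ≐ v)
  esym : ∀ {w v} → (w ≐ v) ∈ items s → EqRule s (v ≐ w)
  etran : ∀ {w v u} → (w ≐ v) ∈ items s → (v ≐ u) ∈ items s → EqRule s (w ≐ u)

data ClosureApp (s : State) : Set where
  c⊥₁ : ∀ {w v} → (w ≐ v) ∈ items s → (w ≠ v) ∈ items s → ClosureApp s
  c⊥₂ : ∀ {n m} → (plus n ≐ minus m) ∈ items s → ClosureApp s

Closed : State → Set
Closed s = bot ∈ items s

-- Closure rules are applied
-- eagerly: other rules may only be used when no closure rule applies.
data Step (s : State) : List State → Set where
  close  : ¬ Closed s → ClosureApp s → Step s [ add bot s ]
  decomp : ∀ {alts} → ¬ Closed s → ¬ ClosureApp s → Decomp s alts → Step s alts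
  equal  : ∀ {c} → ¬ Closed s → ¬ ClosureApp s → EqRule s c → c ∉ items s →
           Step s [ add c s ]

data Tableau (s : State) : Set where
  leaf : Tableau s
  node : ∀ {alts} → Step s alts → ((t : State) → t ∈ alts → Tableau t) → Tableau s

AllBranches : (P : State → Set) → ∀ {s} → Tableau s → Set
AllBranches P {s} leaf = P s
AllBranches P (node {alts} _ k) = ∀ t (m : t ∈ alts) → AllBranches P (k t m)

SomeBranch : (P : State → Set) → ∀ {s} → Tableau s → Set
SomeBranch P {s} leaf = P s
SomeBranch P (node {alts} _ k) = Σ State λ t → Σ (t ∈ alts) λ m → SomeBranch P (k t m)

FullyExpandedBranch : State → Set
FullyExpandedBranch s = Closed s ⊎ (∀ alts → ¬ Step s alts)

OpenTableau : ∀ {s} → Tableau s → Set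
OpenTableau t = SomeBranch (λ s → ¬ Closed s) t

FullyExpanded : ∀ {s} → Tableau s → Set
FullyExpanded t = AllBranches FullyExpandedBranch t

root : ℕ → Formula → State
root n φ = st [ plus n ∶ φ ] []

TableauSatisfiable : Formula → Set
TableauSatisfiable φ = ∃[ n ] Σ (Tableau (root n φ)) λ t → OpenTableau t × FullyExpanded t

-- Let V satisfy φ in an SCI-model. Along a suitable branch of any tableau rooted at w⁺ : φ one can
-- interpret labels in U so that every item is realised (w : ψ by V ψ), labels in L⁺ go into D and
-- labels in L⁻ do not: some alternative of each decomposition rule stays realisable by interpreting
-- the fresh labels as the values of the subformulas, equality rules stay realised because V commutes
-- with the connectives, and so no closure rule can ever apply.  Hence no tableau for φ is closed.
-- A fully expanded tableau exists because each decomposition strictly decreases the total size of the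
-- labelled formulas not yet decomposed, after which the equality rules only relate the finitely many
-- labels already present.  Closedness of the finite result is decidable, so it has an open branch.
module Submission where

open import Defs
open import Data.Nat using (ℕ; suc; _+_; _≤_; _<_; z≤n; s≤s)
open import Data.Nat.Properties
  using (≤-refl; ≤-reflexive; ≤-trans; ≤-<-trans; module ≤-Reasoning; +-mono-≤; +-mono-<-≤; +-monoʳ-≤; +-comm; +-assoc; +-identityʳ; n≮n; 1+n≢n; n≤1+n)
  renaming (_≟_ to _≟ⁿ_)
open import Data.Nat.Induction using (<-wellFounded)
open import Data.Nat.ListAction using (sum)
open import Data.Nat.ListAction.Properties using (sum-++)
open import Induction.WellFounded using (Acc; acc)
open import Data.List using (List; []; _∷_; [_]; _++_; map; concatMap; cartesianProduct)
open import Data.List.Properties using (map-++)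
open import Data.List.Extrema.Nat using (max; xs≤max)
open import Data.List.Membership.Propositional using (_∈_; _∉_; find; lose)
open import Data.List.Membership.Propositional.Properties using (∈-map⁺; ∈-concatMap⁺; ∈-cartesianProduct⁺)
open import Data.List.Relation.Unary.Any using (Any; here; there; any?)
open import Data.List.Relation.Unary.All as All using (All; []; _∷_)
open import Data.List.Relation.Unary.All.Properties using (++⁺)
open import Data.Product using (Σ; _×_; _,_; ∃; ∃₂; proj₁; proj₂; uncurry)
open import Data.Product.Properties using (≡-dec)
open import Data.Sum using (_⊎_; inj₁; inj₂)
open import Data.Empty using (⊥)
open import Data.Unit using (⊤; tt)
open import Function using (_∘_)
open import Relation.Nullary using (¬_; Dec; yes; no)
open import Relation.Nullary.Decidable using (map′; _×-dec_; _⊎-dec_; ¬?; decidable-stable; ¬¬-excluded-middle)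
open import Relation.Nullary.Negation using (contradiction)
open import Relation.Binary.Definitions using (DecidableEquality)
open import Relation.Binary.PropositionalEquality using (_≡_; _≢_; refl; sym; trans; subst; cong; cong₂; module ≡-Reasoning)

infix 4 _≟ᶠ_ _≟ˢ_ _≟ˡ_ _≟ⁱ_

_≟ᶠ_ : DecidableEquality Formula
atom n ≟ᶠ atom m = map′ (cong atom) (λ { refl → refl }) (n ≟ⁿ m)
(~ φ) ≟ᶠ (~ ψ) = map′ (cong ~_) (λ { refl → refl }) (φ ≟ᶠ ψ)
(φ ⇒ χ) ≟ᶠ (ψ ⇒ θ) = map′ (uncurry (cong₂ _⇒_)) (λ { refl → refl , refl }) (φ ≟ᶠ ψ ×-dec χ ≟ᶠ θ)
(φ ≣ χ) ≟ᶠ (ψ ≣ θ) = map′ (uncurry (cong₂ _≣_)) (λ { refl → refl , refl }) (φ ≟ᶠ ψ ×-dec χ ≟ᶠ θ)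
atom _ ≟ᶠ (~ _) = no λ ()
atom _ ≟ᶠ (_ ⇒ _) = no λ ()
atom _ ≟ᶠ (_ ≣ _) = no λ ()
(~ _) ≟ᶠ atom _ = no λ ()
(~ _) ≟ᶠ (_ ⇒ _) = no λ ()
(~ _) ≟ᶠ (_ ≣ _) = no λ ()
(_ ⇒ _) ≟ᶠ atom _ = no λ ()
(_ ⇒ _) ≟ᶠ (~ _) = no λ ()
(_ ⇒ _) ≟ᶠ (_ ≣ _) = no λ ()
(_ ≣ _) ≟ᶠ atom _ = no λ ()
(_ ≣ _) ≟ᶠ (~ _) = no λ ()
(_ ≣ _) ≟ᶠ (_ ⇒ _) = no λ ()

_≟ˢ_ : DecidableEquality Sign
pos ≟ˢ pos = yes refl
pos ≟ˢ negv = no λ ()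
negv ≟ˢ pos = no λ ()
negv ≟ˢ negv = yes refl

_≟ˡ_ : DecidableEquality Label
lab a i ≟ˡ lab b j = map′ (λ { (refl , refl) → refl }) (λ { refl → refl , refl }) (a ≟ˢ b ×-dec i ≟ⁿ j)

_≟ⁱ_ : DecidableEquality Item
(w ∶ φ) ≟ⁱ (v ∶ ψ) = map′ (λ { (refl , refl) → refl }) (λ { refl → refl , refl }) (w ≟ˡ v ×-dec φ ≟ᶠ ψ)
(w ≐ w′) ≟ⁱ (v ≐ v′) = map′ (λ { (refl , refl) → refl }) (λ { refl → refl , refl }) (w ≟ˡ v ×-dec w′ ≟ˡ v′)
(w ≠ w′) ≟ⁱ (v ≠ v′) = map′ (λ { (refl , refl) → refl }) (λ { refl → refl , refl }) (w ≟ˡ v ×-dec w′ ≟ˡ v′)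
bot ≟ⁱ bot = yes refl
(_ ∶ _) ≟ⁱ (_ ≐ _) = no λ ()
(_ ∶ _) ≟ⁱ (_ ≠ _) = no λ ()
(_ ∶ _) ≟ⁱ bot = no λ ()
(_ ≐ _) ≟ⁱ (_ ∶ _) = no λ ()
(_ ≐ _) ≟ⁱ (_ ≠ _) = no λ ()
(_ ≐ _) ≟ⁱ bot = no λ ()
(_ ≠ _) ≟ⁱ (_ ∶ _) = no λ ()
(_ ≠ _) ≟ⁱ (_ ≐ _) = no λ ()
(_ ≠ _) ≟ⁱ bot = no λ ()
bot ≟ⁱ (_ ∶ _) = no λ ()
bot ≟ⁱ (_ ≐ _) = no λ ()
bot ≟ⁱ (_ ≠ _) = no λ ()

open import Data.List.Membership.DecPropositional _≟ⁱ_ using () renaming (_∈?_ to _∈ⁱ?_)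
open import Data.List.Membership.DecPropositional (≡-dec _≟ˡ_ _≟ᶠ_) using () renaming (_∈?_ to _∈ᵘ?_)

labelled : List Item → List (Label × Formula)
labelled [] = []
labelled ((w ∶ φ) ∷ is) = (w , φ) ∷ labelled is
labelled ((_ ≐ _) ∷ is) = labelled is
labelled ((_ ≠ _) ∷ is) = labelled is
labelled (bot ∷ is) = labelled is

equalities : List Item → List (Label × Label)
equalities [] = []
equalities ((w ≐ v) ∷ is) = (w , v) ∷ equalities is
equalities ((_ ∶ _) ∷ is) = equalities is
equalities ((_ ≠ _) ∷ is) = equalities is
equalities (bot ∷ is) = equalities is

∈-labelled⁺ : ∀ {w φ is} → (w ∶ φ) ∈ is → (w , φ) ∈ labelled is
∈-labelled⁺ (here refl) = here refl
∈-labelled⁺ {is = (_ ∶ _) ∷ _} (there m) = there (∈-labelled⁺ m)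
∈-labelled⁺ {is = (_ ≐ _) ∷ _} (there m) = ∈-labelled⁺ m
∈-labelled⁺ {is = (_ ≠ _) ∷ _} (there m) = ∈-labelled⁺ m
∈-labelled⁺ {is = bot ∷ _} (there m) = ∈-labelled⁺ m

∈-labelled⁻ : ∀ {w φ} is → (w , φ) ∈ labelled is → (w ∶ φ) ∈ is
∈-labelled⁻ ((_ ∶ _) ∷ is) (here refl) = here refl
∈-labelled⁻ ((_ ∶ _) ∷ is) (there m) = there (∈-labelled⁻ is m)
∈-labelled⁻ ((_ ≐ _) ∷ is) m = there (∈-labelled⁻ is m)
∈-labelled⁻ ((_ ≠ _) ∷ is) m = there (∈-labelled⁻ is m)
∈-labelled⁻ (bot ∷ is) m = there (∈-labelled⁻ is m)

∈-equalities⁺ : ∀ {w v is} → (w ≐ v) ∈ is → (w , v) ∈ equalities is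
∈-equalities⁺ (here refl) = here refl
∈-equalities⁺ {is = (_ ≐ _) ∷ _} (there m) = there (∈-equalities⁺ m)
∈-equalities⁺ {is = (_ ∶ _) ∷ _} (there m) = ∈-equalities⁺ m
∈-equalities⁺ {is = (_ ≠ _) ∷ _} (there m) = ∈-equalities⁺ m
∈-equalities⁺ {is = bot ∷ _} (there m) = ∈-equalities⁺ m

∈-equalities⁻ : ∀ {w v} is → (w , v) ∈ equalities is → (w ≐ v) ∈ is
∈-equalities⁻ ((_ ≐ _) ∷ is) (here refl) = here refl
∈-equalities⁻ ((_ ≐ _) ∷ is) (there m) = there (∈-equalities⁻ is m)
∈-equalities⁻ ((_ ∶ _) ∷ is) m = there (∈-equalities⁻ is m)
∈-equalities⁻ ((_ ≠ _) ∷ is) m = there (∈-equalities⁻ is m)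
∈-equalities⁻ (bot ∷ is) m = there (∈-equalities⁻ is m)

labelled-++ : ∀ cs is → labelled (cs ++ is) ≡ labelled cs ++ labelled is
labelled-++ [] is = refl
labelled-++ ((w ∶ φ) ∷ cs) is = cong ((w , φ) ∷_) (labelled-++ cs is)
labelled-++ ((_ ≐ _) ∷ cs) is = labelled-++ cs is
labelled-++ ((_ ≠ _) ∷ cs) is = labelled-++ cs is
labelled-++ (bot ∷ cs) is = labelled-++ cs is

data Congruence (s : State) : Formula → Formula → Set where
  ~-cong : ∀ {φ ψ} → Approx s φ ψ → Congruence s (~ φ) (~ ψ)
  ⇒-cong : ∀ {φ ψ χ θ} → Approx s φ ψ → Approx s χ θ → Congruence s (φ ⇒ χ) (ψ ⇒ θ)
  ≣-cong : ∀ {φ ψ χ θ} → Approx s φ ψ → Approx s χ θ → Congruence s (φ ≣ χ) (ψ ≣ θ)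

Identified : State → Formula → Formula → Set
Identified s α β = α ≡ β ⊎ Congruence s α β

identified⇒eqRule : ∀ {s x z α β} → Identified s α β →
                    (x ∶ α) ∈ items s → (z ∶ β) ∈ items s → EqRule s (x ≐ z)
identified⇒eqRule (inj₁ refl) = eF
identified⇒eqRule (inj₂ (~-cong a)) = e¬ a
identified⇒eqRule (inj₂ (⇒-cong a b)) = e⇒ a b
identified⇒eqRule (inj₂ (≣-cong a b)) = e≣ a b

-- Soundness of the rules with respect to SCI-models

module Soundness (M : SCIModel) (val : Valuation M) where
  open SCIModel M
  open Valuation val
  open ≡-Reasoning

  ~-elim : ∀ φ → D (V (~ φ)) → ¬ D (V φ)
  ~-elim φ d = proj₁ (neg-D (V φ)) (subst D (V-neg φ) d)

  ~-intro : ∀ φ → ¬ D (V φ) → D (V (~ φ))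
  ~-intro φ nd = subst D (sym (V-neg φ)) (proj₂ (neg-D (V φ)) nd)

  ⇒-elim : ∀ φ ψ → D (V (φ ⇒ ψ)) → D (V φ) → D (V ψ)
  ⇒-elim φ ψ d dφ with proj₁ (imp-D (V φ) (V ψ)) (subst D (V-imp φ ψ) d)
  ... | inj₁ ¬dφ = contradiction dφ ¬dφ
  ... | inj₂ dψ = dψ

  ⇒-intro : ∀ φ ψ → ¬ D (V φ) ⊎ D (V ψ) → D (V (φ ⇒ ψ))
  ⇒-intro φ ψ h = subst D (sym (V-imp φ ψ)) (proj₂ (imp-D (V φ) (V ψ)) h)

  ≣-elim : ∀ φ ψ → D (V (φ ≣ ψ)) → V φ ≡ V ψ
  ≣-elim φ ψ d = proj₁ (eqv-D (V φ) (V ψ)) (subst D (V-eqv φ ψ) d)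

  ≣-intro : ∀ φ ψ → V φ ≡ V ψ → D (V (φ ≣ ψ))
  ≣-intro φ ψ e = subst D (sym (V-eqv φ ψ)) (proj₂ (eqv-D (V φ) (V ψ)) e)

  Interpretation : Set
  Interpretation = Label → U

  HasSign : Label → U → Set
  HasSign (lab pos _) a = D a
  HasSign (lab negv _) a = ¬ D a

  Respects : Interpretation → Set
  Respects I = ∀ x → HasSign x (I x)

  Realises : Interpretation → Item → Set
  Realises I (w ∶ φ) = I w ≡ V φ
  Realises I (w ≐ v) = I w ≡ I v
  Realises I (w ≠ v) = I w ≢ I v
  Realises I bot = ⊥

  record Models (I : Interpretation) (s : State) : Set where
    constructor models
    field
      realised  : All (Realises I) (items s)
      respected : Respects I
  open Models

  holds : ∀ {I s i} → Models I s → i ∈ items s → Realises I i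
  holds g = All.lookup (realised g)

  designated : ∀ {I s n φ} → Models I s → (plus n ∶ φ) ∈ items s → D (V φ)
  designated {n = n} g m = subst D (holds g m) (respected g (plus n))

  undesignated : ∀ {I s n φ} → Models I s → (minus n ∶ φ) ∈ items s → ¬ D (V φ)
  undesignated {n = n} g m d = respected g (minus n) (subst D (sym (holds g m)) d)

  _[_≔_] : Interpretation → Label → U → Interpretation
  (I [ x ≔ a ]) y with y ≟ˡ x
  ... | yes _ = a
  ... | no _ = I y

  update-same : ∀ I x a → (I [ x ≔ a ]) x ≡ a
  update-same I x a with x ≟ˡ x
  ... | yes _ = refl
  ... | no x≢x = contradiction refl x≢x

  update-other : ∀ I {x} a {y} → y ≢ x → (I [ x ≔ a ]) y ≡ I y
  update-other I {x} a {y} y≢x with y ≟ˡ x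
  ... | yes y≡x = contradiction y≡x y≢x
  ... | no _ = refl

  respects-update : ∀ {I x a} → Respects I → HasSign x a → Respects (I [ x ≔ a ])
  respects-update {I} {x} resp sx y with y ≟ˡ x
  ... | yes refl = sx
  ... | no _ = resp y

  realises-update : ∀ {I x} a i → ¬ Occurs x i → Realises I i → Realises (I [ x ≔ a ]) i
  realises-update {I} a (w ∶ φ) x∉ r = trans (update-other I a (x∉ ∘ sym)) r
  realises-update {I} a (w ≐ v) x∉ r =
    trans (update-other I a (x∉ ∘ inj₁ ∘ sym)) (trans r (sym (update-other I a (x∉ ∘ inj₂ ∘ sym))))
  realises-update {I} a (w ≠ v) x∉ r e =
    r (trans (sym (update-other I a (x∉ ∘ inj₁ ∘ sym))) (trans e (update-other I a (x∉ ∘ inj₂ ∘ sym))))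

  realises-fresh : ∀ {I x} a {is} → ¬ Any (Occurs x) is → All (Realises I) is → All (Realises (I [ x ≔ a ])) is
  realises-fresh a x∉ [] = []
  realises-fresh a {i ∷ _} x∉ (r ∷ rs) = realises-update a i (x∉ ∘ here) r ∷ realises-fresh a (x∉ ∘ there) rs

  models-fresh : ∀ {I s x a} → Models I s → Fresh s x → HasSign x a → Models (I [ x ≔ a ]) s
  models-fresh {a = a} g x∉ sx = models (realises-fresh a x∉ (realised g)) (respects-update (respected g) sx)

  SomeAlternativeModelled : List State → Set
  SomeAlternativeModelled alts = ∃ λ t → t ∈ alts × ∃ λ J → Models J t

  unary-conclusion : ∀ {I s w χ x φ} → Models I s → Fresh s x → HasSign x (V φ) →
                     ∃ λ J → Models J (ext s w χ [ x ∶ φ ])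
  unary-conclusion {I} {x = x} {φ} g x∉ sx =
    _ , models (update-same I x (V φ) ∷ realised g′) (respected g′)
    where g′ = models-fresh g x∉ sx

  binary-conclusion : ∀ {I s w χ x y φ ψ extra} → Models I s → FreshPair s x y →
                      HasSign x (V φ) → HasSign y (V ψ) →
                      (∀ {J} → J x ≡ V φ → J y ≡ V ψ → All (Realises J) extra) →
                      ∃ λ J → Models J (ext s w χ (x ∶ φ ∷ y ∶ ψ ∷ extra))
  binary-conclusion {I} {x = x} {y} {φ} {ψ} g (x∉ , y∉ , x≢y) sx sy realises-extra =
    _ , models (Jx ∷ Jy ∷ ++⁺ (realises-extra Jx Jy) (realised g′)) (respected g′)
    where
    g′ = models-fresh (models-fresh g x∉ sx) y∉ sy
    Jx = trans (update-other (I [ x ≔ V φ ]) (V ψ) x≢y) (update-same I x (V φ))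
    Jy = update-same (I [ x ≔ V φ ]) y (V ψ)

  realises-≐ : ∀ {J x y a b} → a ≡ b → J x ≡ a → J y ≡ b → All (Realises J) [ x ≐ y ]
  realises-≐ a=b Jx Jy = trans Jx (trans a=b (sym Jy)) ∷ []

  realises-≠ : ∀ {J x y a b} → a ≢ b → J x ≡ a → J y ≡ b → All (Realises J) [ x ≠ y ]
  realises-≠ a≠b Jx Jy = (λ e → a≠b (trans (sym Jx) (trans e Jy))) ∷ []

  -- D need not be decidable, so the case splits on designation happen under a double negation.
  decomp-sound : ∀ {I s alts} → Models I s → Decomp s alts → ¬ ¬ SomeAlternativeModelled alts
  decomp-sound g (d¬⁺ {φ = φ} m _ x∉) k =
    k (_ , here refl , unary-conclusion g x∉ (~-elim φ (designated g m)))
  decomp-sound g (d¬⁻ {φ = φ} m _ x∉) k = ¬¬-excluded-middle {A = D (V φ)} λ where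
    (yes d) → k (_ , here refl , unary-conclusion g x∉ d)
    (no ¬d) → undesignated g m (~-intro φ ¬d)
  decomp-sound g (d⇒⁺ {φ = φ} {ψ} m _ f₁ f₂ f₃) k = ¬¬-excluded-middle {A = D (V φ)} λ where
    (yes dφ) → k (_ , there (there (here refl)) ,
                  binary-conclusion g f₃ dφ (⇒-elim φ ψ (designated g m) dφ) λ _ _ → [])
    (no ¬dφ) → ¬¬-excluded-middle {A = D (V ψ)} λ where
      (yes dψ) → k (_ , there (here refl) , binary-conclusion g f₂ ¬dφ dψ λ _ _ → [])
      (no ¬dψ) → k (_ , here refl , binary-conclusion g f₁ ¬dφ ¬dψ λ _ _ → [])
  decomp-sound g (d⇒⁻ {φ = φ} {ψ} m _ f) k = ¬¬-excluded-middle {A = D (V φ)} λ where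
    (yes dφ) → k (_ , here refl , binary-conclusion g f dφ (undesignated g m ∘ ⇒-intro φ ψ ∘ inj₂) λ _ _ → [])
    (no ¬dφ) → undesignated g m (⇒-intro φ ψ (inj₁ ¬dφ))
  decomp-sound g (d≣⁺ {φ = φ} {ψ} m _ f₁ f₂) k =
    let φ=ψ = ≣-elim φ ψ (designated g m) in
    ¬¬-excluded-middle {A = D (V φ)} λ where
    (yes dφ) → k (_ , here refl , binary-conclusion g f₁ dφ (subst D φ=ψ dφ) (realises-≐ φ=ψ))
    (no ¬dφ) → k (_ , there (here refl) , binary-conclusion g f₂ ¬dφ (¬dφ ∘ subst D (sym φ=ψ)) (realises-≐ φ=ψ))
  decomp-sound g (d≣⁻ {φ = φ} {ψ} m _ f₁ f₂ f₃ f₄) k =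
    let φ≠ψ = undesignated g m ∘ ≣-intro φ ψ in
    ¬¬-excluded-middle {A = D (V φ)} λ where
    (yes dφ) → ¬¬-excluded-middle {A = D (V ψ)} λ where
      (yes dψ) → k (_ , here refl , binary-conclusion g f₁ dφ dψ (realises-≠ φ≠ψ))
      (no ¬dψ) → k (_ , there (here refl) , binary-conclusion g f₂ dφ ¬dψ λ _ _ → [])
    (no ¬dφ) → ¬¬-excluded-middle {A = D (V ψ)} λ where
      (yes dψ) → k (_ , there (there (here refl)) , binary-conclusion g f₃ ¬dφ dψ λ _ _ → [])
      (no ¬dψ) → k (_ , there (there (there (here refl))) , binary-conclusion g f₄ ¬dφ ¬dψ (realises-≠ φ≠ψ))

  closure-sound : ∀ {I s} → Models I s → ¬ ClosureApp s
  closure-sound g (c⊥₁ e ne) = holds g ne (holds g e)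
  closure-sound g (c⊥₂ {n} {m} e) = respected g (minus m) (subst D (holds g e) (respected g (plus n)))

  approx-sound : ∀ {I s φ ψ} → Models I s → Approx s φ ψ → V φ ≡ V ψ
  approx-sound g (_ , _ , mφ , mψ , e) = trans (sym (holds g mφ)) (trans (holds g e) (holds g mψ))

  identified-sound : ∀ {I s α β} → Models I s → Identified s α β → V α ≡ V β
  identified-sound g (inj₁ refl) = refl
  identified-sound g (inj₂ (~-cong {φ} {ψ} a)) = begin
    V (~ φ)      ≡⟨ V-neg φ ⟩
    neg (V φ)    ≡⟨ cong neg (approx-sound g a) ⟩
    neg (V ψ)    ≡⟨ V-neg ψ ⟨
    V (~ ψ)      ∎
  identified-sound g (inj₂ (⇒-cong {φ} {ψ} {χ} {θ} a b)) = begin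
    V (φ ⇒ χ)          ≡⟨ V-imp φ χ ⟩
    imp (V φ) (V χ)    ≡⟨ cong₂ imp (approx-sound g a) (approx-sound g b) ⟩
    imp (V ψ) (V θ)    ≡⟨ V-imp ψ θ ⟨
    V (ψ ⇒ θ)          ∎
  identified-sound g (inj₂ (≣-cong {φ} {ψ} {χ} {θ} a b)) = begin
    V (φ ≣ χ)          ≡⟨ V-eqv φ χ ⟩
    eqv (V φ) (V χ)    ≡⟨ cong₂ eqv (approx-sound g a) (approx-sound g b) ⟩
    eqv (V ψ) (V θ)    ≡⟨ V-eqv ψ θ ⟨
    V (ψ ≣ θ)          ∎

  identified-labels : ∀ {I s x z α β} → Models I s → Identified s α β →
                      (x ∶ α) ∈ items s → (z ∶ β) ∈ items s → I x ≡ I z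
  identified-labels g idf m₁ m₂ = trans (holds g m₁) (trans (identified-sound g idf) (sym (holds g m₂)))

  eqRule-sound : ∀ {I s c} → Models I s → EqRule s c → Realises I c
  eqRule-sound g (e¬ a m₁ m₂) = identified-labels g (inj₂ (~-cong a)) m₁ m₂
  eqRule-sound g (e⇒ a b m₁ m₂) = identified-labels g (inj₂ (⇒-cong a b)) m₁ m₂
  eqRule-sound g (e≣ a b m₁ m₂) = identified-labels g (inj₂ (≣-cong a b)) m₁ m₂
  eqRule-sound g (eF m₁ m₂) = identified-labels g (inj₁ refl) m₁ m₂
  eqRule-sound g (esym e) = sym (holds g e)
  eqRule-sound g (etran e₁ e₂) = trans (holds g e₁) (holds g e₂)

  no-closed-tableau : ∀ {I s} → Models I s → (t : Tableau s) → ¬ AllBranches Closed t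
  no-closed-tableau g leaf closed = holds g closed
  no-closed-tableau g (node (close _ ca) _) _ = closure-sound g ca
  no-closed-tableau g (node (equal _ _ rule _) k) closed =
    no-closed-tableau (models (eqRule-sound g rule ∷ realised g) (respected g)) (k _ (here refl)) (closed _ (here refl))
  no-closed-tableau g (node (decomp _ _ rule) k) closed =
    decomp-sound g rule λ (t , m , _ , g′) → no-closed-tableau g′ (k t m) (closed t m)

  -- V (p ≣ p) is designated and V (~ (p ≣ p)) is not, so both signs have witnesses in U.
  signed-default : Interpretation
  signed-default (lab pos _) = V (atom 0 ≣ atom 0)
  signed-default (lab negv _) = V (~ (atom 0 ≣ atom 0))

  signed-default-respects : Respects signed-default
  signed-default-respects (lab pos _) = ≣-intro (atom 0) (atom 0) refl
  signed-default-respects (lab negv _) d = ~-elim (atom 0 ≣ atom 0) d (signed-default-respects (plus 0))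

  root-model : ∀ {φ} → D (V φ) → ∃ λ I → Models I (root 0 φ)
  root-model {φ} d =
    signed-default [ plus 0 ≔ V φ ] ,
    models (update-same signed-default (plus 0) (V φ) ∷ []) (respects-update signed-default-respects d)

Clash : State → Label × Label → Set
Clash s (w , v) = (w ≠ v) ∈ items s ⊎ (Label.sign w ≡ pos × Label.sign v ≡ negv)

closure? : ∀ s → Dec (ClosureApp s)
closure? s = map′ (found ∘ find) lost (any? clash? (equalities (items s)))
  where
  clash? : ∀ p → Dec (Clash s p)
  clash? (w , v) = ((w ≠ v) ∈ⁱ? items s) ⊎-dec (Label.sign w ≟ˢ pos ×-dec Label.sign v ≟ˢ negv)
  found : ∃ (λ p → p ∈ equalities (items s) × Clash s p) → ClosureApp s
  found (_ , e , inj₁ ne) = c⊥₁ (∈-equalities⁻ (items s) e) ne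
  found ((lab _ _ , lab _ _) , e , inj₂ (refl , refl)) = c⊥₂ (∈-equalities⁻ (items s) e)
  lost : ClosureApp s → Any (Clash s) (equalities (items s))
  lost (c⊥₁ e ne) = lose (∈-equalities⁺ e) (inj₁ ne)
  lost (c⊥₂ e) = lose (∈-equalities⁺ e) (inj₂ (refl , refl))

approx? : ∀ s φ ψ → Dec (Approx s φ ψ)
approx? s φ ψ = map′ (found ∘ find) lost (any? witnesses? (equalities (items s)))
  where
  Witnesses : Label × Label → Set
  Witnesses (w , v) = (w ∶ φ) ∈ items s × (v ∶ ψ) ∈ items s
  witnesses? : ∀ p → Dec (Witnesses p)
  witnesses? (w , v) = ((w ∶ φ) ∈ⁱ? items s) ×-dec ((v ∶ ψ) ∈ⁱ? items s)
  found : ∃ (λ p → p ∈ equalities (items s) × Witnesses p) → Approx s φ ψ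
  found ((w , v) , e , mφ , mψ) = w , v , mφ , mψ , ∈-equalities⁻ (items s) e
  lost : Approx s φ ψ → Any Witnesses (equalities (items s))
  lost (_ , _ , mφ , mψ , e) = lose (∈-equalities⁺ e) (mφ , mψ)

congruence? : ∀ s α β → Dec (Congruence s α β)
congruence? s (~ φ) (~ ψ) = map′ ~-cong (λ { (~-cong a) → a }) (approx? s φ ψ)
congruence? s (φ ⇒ χ) (ψ ⇒ θ) =
  map′ (uncurry ⇒-cong) (λ { (⇒-cong a b) → a , b }) (approx? s φ ψ ×-dec approx? s χ θ)
congruence? s (φ ≣ χ) (ψ ≣ θ) =
  map′ (uncurry ≣-cong) (λ { (≣-cong a b) → a , b }) (approx? s φ ψ ×-dec approx? s χ θ)
congruence? s (atom _) _ = no λ ()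
congruence? s (~ _) (atom _) = no λ ()
congruence? s (~ _) (_ ⇒ _) = no λ ()
congruence? s (~ _) (_ ≣ _) = no λ ()
congruence? s (_ ⇒ _) (atom _) = no λ ()
congruence? s (_ ⇒ _) (~ _) = no λ ()
congruence? s (_ ⇒ _) (_ ≣ _) = no λ ()
congruence? s (_ ≣ _) (atom _) = no λ ()
congruence? s (_ ≣ _) (~ _) = no λ ()
congruence? s (_ ≣ _) (_ ⇒ _) = no λ ()

NewEquality : State → Set
NewEquality s = ∃₂ λ w v → EqRule s (w ≐ v) × (w ≐ v) ∉ items s

EqSaturated : State → Set
EqSaturated s = ∀ {c} → EqRule s c → c ∈ items s

-- An equality rule is determined by the two labelled formulas, one equality or two equalities whose
-- labels it relates, so it suffices to search pairs of such items on the branch.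
module EqualitySearch (s : State) where
  IdentificationMissing : Label × Formula → Label × Formula → Set
  IdentificationMissing (x , α) (z , β) = Identified s α β × (x ≐ z) ∉ items s

  SymmetricMissing : Label × Label → Set
  SymmetricMissing (w , v) = (v ≐ w) ∉ items s

  TransitiveMissing : Label × Label → Label × Label → Set
  TransitiveMissing (w , v) (v′ , u) = v ≡ v′ × (w ≐ u) ∉ items s

  Unsaturated : Set
  Unsaturated = Any (λ p → Any (IdentificationMissing p) (labelled (items s))) (labelled (items s))
              ⊎ Any SymmetricMissing (equalities (items s))
              ⊎ Any (λ e → Any (TransitiveMissing e) (equalities (items s))) (equalities (items s))

  unsaturated? : Dec Unsaturated
  unsaturated? =
    any? (λ p → any? (identificationMissing? p) (labelled (items s))) (labelled (items s))
    ⊎-dec any? (λ (w , v) → ¬? ((v ≐ w) ∈ⁱ? items s)) (equalities (items s))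
    ⊎-dec any? (λ e → any? (transitiveMissing? e) (equalities (items s))) (equalities (items s))
    where
    identificationMissing? : ∀ p q → Dec (IdentificationMissing p q)
    identificationMissing? (x , α) (z , β) =
      (α ≟ᶠ β ⊎-dec congruence? s α β) ×-dec ¬? ((x ≐ z) ∈ⁱ? items s)
    transitiveMissing? : ∀ e f → Dec (TransitiveMissing e f)
    transitiveMissing? (w , v) (v′ , u) = (v ≟ˡ v′) ×-dec ¬? ((w ≐ u) ∈ⁱ? items s)

  unsaturated⇒new : Unsaturated → NewEquality s
  unsaturated⇒new (inj₁ a)
    with (x , α) , m₁ , a′ ← find a
    with (z , β) , m₂ , idf , missing ← find a′ =
    _ , _ , identified⇒eqRule idf (∈-labelled⁻ (items s) m₁) (∈-labelled⁻ (items s) m₂) , missing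
  unsaturated⇒new (inj₂ (inj₁ a))
    with (w , v) , e , missing ← find a =
    _ , _ , esym (∈-equalities⁻ (items s) e) , missing
  unsaturated⇒new (inj₂ (inj₂ a))
    with (w , v) , e₁ , a′ ← find a
    with (_ , u) , e₂ , refl , missing ← find a′ =
    _ , _ , etran (∈-equalities⁻ (items s) e₁) (∈-equalities⁻ (items s) e₂) , missing

  identification-missing : ∀ {x z α β} → Identified s α β → (x ∶ α) ∈ items s → (z ∶ β) ∈ items s →
                           (x ≐ z) ∉ items s → Unsaturated
  identification-missing idf m₁ m₂ missing = inj₁ (lose (∈-labelled⁺ m₁) (lose (∈-labelled⁺ m₂) (idf , missing)))

  new⇒unsaturated : ∀ {c} → EqRule s c → c ∉ items s → Unsaturated
  new⇒unsaturated (e¬ a m₁ m₂) = identification-missing (inj₂ (~-cong a)) m₁ m₂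
  new⇒unsaturated (e⇒ a b m₁ m₂) = identification-missing (inj₂ (⇒-cong a b)) m₁ m₂
  new⇒unsaturated (e≣ a b m₁ m₂) = identification-missing (inj₂ (≣-cong a b)) m₁ m₂
  new⇒unsaturated (eF m₁ m₂) = identification-missing (inj₁ refl) m₁ m₂
  new⇒unsaturated (esym e) missing = inj₂ (inj₁ (lose (∈-equalities⁺ e) missing))
  new⇒unsaturated (etran e₁ e₂) missing = inj₂ (inj₂ (lose (∈-equalities⁺ e₁) (lose (∈-equalities⁺ e₂) (refl , missing))))

new-equality-or-saturated : ∀ s → NewEquality s ⊎ EqSaturated s
new-equality-or-saturated s with EqualitySearch.unsaturated? s
... | yes u = inj₁ (EqualitySearch.unsaturated⇒new s u)
... | no ¬u = inj₂ λ {c} rule → decidable-stable (c ∈ⁱ? items s) (¬u ∘ EqualitySearch.new⇒unsaturated s rule)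

Compound : Formula → Set
Compound (atom _) = ⊥
Compound _ = ⊤

compound? : ∀ φ → Dec (Compound φ)
compound? (atom _) = no λ ()
compound? (~ _) = yes tt
compound? (_ ⇒ _) = yes tt
compound? (_ ≣ _) = yes tt

Pending : State → Set
Pending s = Any (λ (w , φ) → Compound φ × (w , φ) ∉ used s) (labelled (items s))

pending? : ∀ s → Dec (Pending s)
pending? s = any? (λ (w , φ) → compound? φ ×-dec ¬? ((w , φ) ∈ᵘ? used s)) (labelled (items s))

decomp⇒pending : ∀ {s alts} → Decomp s alts → Pending s
decomp⇒pending (d¬⁺ m u _) = lose (∈-labelled⁺ m) (tt , u)
decomp⇒pending (d¬⁻ m u _) = lose (∈-labelled⁺ m) (tt , u)
decomp⇒pending (d⇒⁺ m u _ _ _) = lose (∈-labelled⁺ m) (tt , u)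
decomp⇒pending (d⇒⁻ m u _) = lose (∈-labelled⁺ m) (tt , u)
decomp⇒pending (d≣⁺ m u _ _) = lose (∈-labelled⁺ m) (tt , u)
decomp⇒pending (d≣⁻ m u _ _ _ _) = lose (∈-labelled⁺ m) (tt , u)

-- Fresh labels and termination measures

labelsOf : Item → List Label
labelsOf (w ∶ _) = [ w ]
labelsOf (w ≐ v) = w ∷ v ∷ []
labelsOf (w ≠ v) = w ∷ v ∷ []
labelsOf bot = []

labels : List Item → List Label
labels = concatMap labelsOf

occurs⇒∈labelsOf : ∀ {x} i → Occurs x i → x ∈ labelsOf i
occurs⇒∈labelsOf (w ∶ _) refl = here refl
occurs⇒∈labelsOf (w ≐ v) (inj₁ refl) = here refl
occurs⇒∈labelsOf (w ≐ v) (inj₂ refl) = there (here refl)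
occurs⇒∈labelsOf (w ≠ v) (inj₁ refl) = here refl
occurs⇒∈labelsOf (w ≠ v) (inj₂ refl) = there (here refl)

occurs⇒∈labels : ∀ {x i is} → i ∈ is → Occurs x i → x ∈ labels is
occurs⇒∈labels {i = i} m o = ∈-concatMap⁺ labelsOf (lose m (occurs⇒∈labelsOf i o))

nextIndex : List Item → ℕ
nextIndex is = suc (max 0 (map Label.idx (labels is)))

fresh : ∀ s {a k} → nextIndex (items s) ≤ k → Fresh s (lab a k)
fresh s {k = k} next≤k occ with i , m , o ← find occ =
  n≮n k (≤-trans (s≤s (All.lookup (xs≤max 0 _) (∈-map⁺ Label.idx (occurs⇒∈labels m o)))) next≤k)

freshPair : ∀ s a b → FreshPair s (lab a (nextIndex (items s))) (lab b (suc (nextIndex (items s))))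
freshPair s a b = fresh s ≤-refl , fresh s (n≤1+n _) , λ e → 1+n≢n (sym (cong Label.idx e))

module UnmarkedWeight {A M : Set} {Marked : M → A → Set} (marked? : ∀ m x → Dec (Marked m x)) (g : A → ℕ) where

  weight : M → A → ℕ
  weight m x with marked? m x
  ... | yes _ = 0
  ... | no _ = g x

  total : M → List A → ℕ
  total m xs = sum (map (weight m) xs)

  weight-≤ : ∀ m x → weight m x ≤ g x
  weight-≤ m x with marked? m x
  ... | yes _ = z≤n
  ... | no _ = ≤-refl

  module _ {m m′ : M} (grows : ∀ {x} → Marked m x → Marked m′ x) where

    weight-antitone : ∀ x → weight m′ x ≤ weight m x
    weight-antitone x with marked? m′ x | marked? m x
    ... | yes _ | _ = z≤n
    ... | no _ | no _ = ≤-refl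
    ... | no ¬marked′ | yes marked = contradiction (grows marked) ¬marked′

    total-antitone : ∀ xs → total m′ xs ≤ total m xs
    total-antitone [] = z≤n
    total-antitone (x ∷ xs) = +-mono-≤ (weight-antitone x) (total-antitone xs)

    total-drop : ∀ {x xs} → x ∈ xs → ¬ Marked m x → Marked m′ x → total m′ xs + g x ≤ total m xs
    total-drop {x} {_ ∷ xs} (here refl) ¬marked marked′
      with marked? m′ x | marked? m x
    ... | no ¬marked′ | _ = contradiction marked′ ¬marked′
    ... | yes _ | yes marked = contradiction marked ¬marked
    ... | yes _ | no _ = ≤-trans (≤-reflexive (+-comm (total m′ xs) (g x))) (+-monoʳ-≤ (g x) (total-antitone xs))
    total-drop {x} {y ∷ xs} (there x∈xs) ¬marked marked′ =
      ≤-trans (≤-reflexive (+-assoc (weight m′ y) (total m′ xs) (g x)))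
              (+-mono-≤ (weight-antitone y) (total-drop x∈xs ¬marked marked′))

  total-≤ : ∀ m xs → total m xs ≤ sum (map g xs)
  total-≤ m [] = z≤n
  total-≤ m (x ∷ xs) = +-mono-≤ (weight-≤ m x) (total-≤ m xs)

  total-++ : ∀ m xs ys → total m (xs ++ ys) ≡ total m xs + total m ys
  total-++ m xs ys = trans (cong sum (map-++ (weight m) xs ys)) (sum-++ (map (weight m) xs) (map (weight m) ys))

size : Formula → ℕ
size (atom _) = 1
size (~ φ) = suc (size φ)
size (φ ⇒ ψ) = suc (size φ + size ψ)
size (φ ≣ ψ) = suc (size φ + size ψ)

module Undecomposed = UnmarkedWeight {Marked = λ u p → p ∈ u} (λ u p → p ∈ᵘ? u) (size ∘ proj₂)

undecomposed : State → ℕ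
undecomposed s = Undecomposed.total (used s) (labelled (items s))

ext-decreases : ∀ {s w φ} cs → (w ∶ φ) ∈ items s → (w , φ) ∉ used s →
                sum (map (size ∘ proj₂) (labelled cs)) < size φ → undecomposed (ext s w φ cs) < undecomposed s
ext-decreases {s} {w} {φ} cs m unused smaller = begin-strict
  total u′ (labelled (cs ++ items s))                   ≡⟨ cong (total u′) (labelled-++ cs (items s)) ⟩
  total u′ (labelled cs ++ labelled (items s))          ≡⟨ total-++ u′ (labelled cs) (labelled (items s)) ⟩
  total u′ (labelled cs) + total u′ (labelled (items s)) <⟨ +-mono-<-≤ (≤-<-trans (total-≤ u′ (labelled cs)) smaller) ≤-refl ⟩
  size φ + total u′ (labelled (items s))                ≡⟨ +-comm (size φ) _ ⟩
  total u′ (labelled (items s)) + size φ                ≤⟨ total-drop there (∈-labelled⁺ m) unused (here refl) ⟩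
  total (used s) (labelled (items s))                   ∎
  where
  open Undecomposed
  open ≤-Reasoning
  u′ = (w , φ) ∷ used s

module Unequated = UnmarkedWeight {A = Label × Label} {M = List Item} {Marked = λ is (w , v) → (w ≐ v) ∈ is}
                                  (λ is (w , v) → (w ≐ v) ∈ⁱ? is) (λ _ → 1)

unequated : List Label → State → ℕ
unequated ls s = Unequated.total (items s) (cartesianProduct ls ls)

add-decreases : ∀ {ls s w v} → w ∈ ls → v ∈ ls → (w ≐ v) ∉ items s → unequated ls (add (w ≐ v) s) < unequated ls s
add-decreases {ls} {s} {w} {v} w∈ v∈ missing =
  ≤-trans (≤-reflexive (+-comm 1 (unequated ls (add (w ≐ v) s))))
          (Unequated.total-drop there (∈-cartesianProduct⁺ w∈ v∈) missing (here refl))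

argument-smaller : ∀ φ → size φ + 0 < suc (size φ)
argument-smaller φ = s≤s (≤-reflexive (+-identityʳ (size φ)))

arguments-smaller : ∀ φ ψ → size φ + (size ψ + 0) < suc (size φ + size ψ)
arguments-smaller φ ψ = s≤s (≤-reflexive (cong (size φ +_) (+-identityʳ (size ψ))))

decomp-decreasing : ∀ {s alts} → Decomp s alts → All (λ t → undecomposed t < undecomposed s) alts
decomp-decreasing (d¬⁺ {φ = φ} {v} m u _) =
  ext-decreases [ minus v ∶ φ ] m u (argument-smaller φ) ∷ []
decomp-decreasing (d¬⁻ {φ = φ} {v} m u _) =
  ext-decreases [ plus v ∶ φ ] m u (argument-smaller φ) ∷ []
decomp-decreasing (d⇒⁺ {φ = φ} {ψ} {v₁} {u₁} {v₂} {u₂} {v₃} {u₃} m u _ _ _) =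
    ext-decreases (minus v₁ ∶ φ ∷ minus u₁ ∶ ψ ∷ []) m u (arguments-smaller φ ψ)
  ∷ ext-decreases (minus v₂ ∶ φ ∷ plus u₂ ∶ ψ ∷ []) m u (arguments-smaller φ ψ)
  ∷ ext-decreases (plus v₃ ∶ φ ∷ plus u₃ ∶ ψ ∷ []) m u (arguments-smaller φ ψ)
  ∷ []
decomp-decreasing (d⇒⁻ {φ = φ} {ψ} {v} {u′} m u _) =
  ext-decreases (plus v ∶ φ ∷ minus u′ ∶ ψ ∷ []) m u (arguments-smaller φ ψ) ∷ []
decomp-decreasing (d≣⁺ {φ = φ} {ψ} {v₁} {u₁} {v₂} {u₂} m u _ _) =
    ext-decreases (plus v₁ ∶ φ ∷ plus u₁ ∶ ψ ∷ plus v₁ ≐ plus u₁ ∷ []) m u (arguments-smaller φ ψ)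
  ∷ ext-decreases (minus v₂ ∶ φ ∷ minus u₂ ∶ ψ ∷ minus v₂ ≐ minus u₂ ∷ []) m u (arguments-smaller φ ψ)
  ∷ []
decomp-decreasing (d≣⁻ {φ = φ} {ψ} {v₁} {u₁} {v₂} {u₂} {v₃} {u₃} {v₄} {u₄} m u _ _ _ _) =
    ext-decreases (plus v₁ ∶ φ ∷ plus u₁ ∶ ψ ∷ plus v₁ ≠ plus u₁ ∷ []) m u (arguments-smaller φ ψ)
  ∷ ext-decreases (plus v₂ ∶ φ ∷ minus u₂ ∶ ψ ∷ []) m u (arguments-smaller φ ψ)
  ∷ ext-decreases (minus v₃ ∶ φ ∷ plus u₃ ∶ ψ ∷ []) m u (arguments-smaller φ ψ)
  ∷ ext-decreases (minus v₄ ∶ φ ∷ minus u₄ ∶ ψ ∷ minus v₄ ≠ minus u₄ ∷ []) m u (arguments-smaller φ ψ)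
  ∷ []

decompose : ∀ s → Pending s → ∃ (Decomp s)
decompose s pending with (w , φ) , m , compound , unused ← find pending =
  by-shape w φ (∈-labelled⁻ (items s) m) unused compound
  where
  N = nextIndex (items s)
  N′ = suc N
  by-shape : ∀ w φ → (w ∶ φ) ∈ items s → (w , φ) ∉ used s → Compound φ → ∃ (Decomp s)
  by-shape (lab pos _) (~ φ) m u _ = _ , d¬⁺ {v = N} m u (fresh s ≤-refl)
  by-shape (lab negv _) (~ φ) m u _ = _ , d¬⁻ {v = N} m u (fresh s ≤-refl)
  by-shape (lab pos _) (φ ⇒ ψ) m u _ =
    _ , d⇒⁺ {v₁ = N} {u₁ = N′} {v₂ = N} {u₂ = N′} {v₃ = N} {u₃ = N′}
            m u (freshPair s negv negv) (freshPair s negv pos) (freshPair s pos pos)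
  by-shape (lab negv _) (φ ⇒ ψ) m u _ =
    _ , d⇒⁻ {v = N} {u = N′} m u (freshPair s pos negv)
  by-shape (lab pos _) (φ ≣ ψ) m u _ =
    _ , d≣⁺ {v₁ = N} {u₁ = N′} {v₂ = N} {u₂ = N′} m u (freshPair s pos pos) (freshPair s negv negv)
  by-shape (lab negv _) (φ ≣ ψ) m u _ =
    _ , d≣⁻ {v₁ = N} {u₁ = N′} {v₂ = N} {u₂ = N′} {v₃ = N} {u₃ = N′} {v₄ = N} {u₄ = N′}
            m u (freshPair s pos pos) (freshPair s pos negv) (freshPair s negv pos) (freshPair s negv negv)

-- Building a fully expanded tableau

Expansion : State → Set
Expansion s = Σ (Tableau s) FullyExpanded

expand-by : ∀ {s alts} → Step s alts → All Expansion alts → Expansion s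
expand-by step expansions =
  node step (λ _ m → proj₁ (All.lookup expansions m)) , λ _ m → proj₂ (All.lookup expansions m)

close-branch : ∀ {s} → ¬ Closed s → ClosureApp s → Expansion s
close-branch ¬closed clash = expand-by (close ¬closed clash) ((leaf , inj₁ (here refl)) ∷ [])

LabelsWithin : List Label → State → Set
LabelsWithin ls s = ∀ {i x} → i ∈ items s → Occurs x i → x ∈ ls

eqRule-labels : ∀ {ls s w v} → LabelsWithin ls s → EqRule s (w ≐ v) → w ∈ ls × v ∈ ls
eqRule-labels within (e¬ _ m₁ m₂) = within m₁ refl , within m₂ refl
eqRule-labels within (e⇒ _ _ m₁ m₂) = within m₁ refl , within m₂ refl
eqRule-labels within (e≣ _ _ m₁ m₂) = within m₁ refl , within m₂ refl
eqRule-labels within (eF m₁ m₂) = within m₁ refl , within m₂ refl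
eqRule-labels within (esym e) = within e (inj₂ refl) , within e (inj₁ refl)
eqRule-labels within (etran e₁ e₂) = within e₁ (inj₁ refl) , within e₂ (inj₂ refl)

saturate : ∀ ls s → LabelsWithin ls s → ¬ Pending s → Acc _<_ (unequated ls s) → Expansion s
saturate ls s within settled (acc smaller)
  with bot ∈ⁱ? items s | closure? s | new-equality-or-saturated s
... | yes closed | _ | _ = leaf , inj₁ closed
... | no ¬closed | yes clash | _ = close-branch ¬closed clash
... | no ¬closed | no ¬clash | inj₂ saturated = leaf , inj₂ λ where
  _ (close _ clash) → ¬clash clash
  _ (decomp _ _ rule) → settled (decomp⇒pending rule)
  _ (equal _ _ rule missing) → missing (saturated rule)
... | no ¬closed | no ¬clash | inj₁ (w , v , rule , missing) =
  expand-by (equal ¬closed ¬clash rule missing)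
    (saturate ls (add (w ≐ v) s) within′ settled (smaller (add-decreases {s = s} w∈ v∈ missing)) ∷ [])
  where
  w∈ = proj₁ (eqRule-labels within rule)
  v∈ = proj₂ (eqRule-labels within rule)
  within′ : LabelsWithin ls (add (w ≐ v) s)
  within′ (here refl) (inj₁ refl) = w∈
  within′ (here refl) (inj₂ refl) = v∈
  within′ (there m) o = within m o

expand : ∀ s → Acc _<_ (undecomposed s) → Expansion s
expand s (acc smaller) with bot ∈ⁱ? items s | closure? s | pending? s
... | yes closed | _ | _ = leaf , inj₁ closed
... | no ¬closed | yes clash | _ = close-branch ¬closed clash
... | no ¬closed | no ¬clash | no settled = saturate (labels (items s)) s occurs⇒∈labels settled (<-wellFounded _)
... | no ¬closed | no ¬clash | yes pending with _ , rule ← decompose s pending =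
  expand-by (decomp ¬closed ¬clash rule) (All.map (λ {t} d → expand t (smaller d)) (decomp-decreasing rule))

some-or-all : ∀ {A : Set} (xs : List A) (P Q : ∀ x → x ∈ xs → Set) → (∀ x m → P x m ⊎ Q x m) →
              (∃ λ x → Σ (x ∈ xs) (P x)) ⊎ (∀ x m → Q x m)
some-or-all [] P Q pq = inj₂ λ _ ()
some-or-all (x ∷ xs) P Q pq with pq x (here refl)
... | inj₁ p = inj₁ (x , here refl , p)
... | inj₂ q with some-or-all xs (λ y → P y ∘ there) (λ y → Q y ∘ there) (λ y → pq y ∘ there)
...   | inj₁ (y , m , p) = inj₁ (y , there m , p)
...   | inj₂ qs = inj₂ λ where
  _ (here refl) → q
  y (there m) → qs y m

open-or-closed : ∀ {s} (t : Tableau s) → OpenTableau t ⊎ AllBranches Closed t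
open-or-closed {s} leaf with bot ∈ⁱ? items s
... | yes closed = inj₂ closed
... | no ¬closed = inj₁ ¬closed
open-or-closed (node {alts} _ k) =
  some-or-all alts (λ t m → OpenTableau (k t m)) (λ t m → AllBranches Closed (k t m)) (λ t m → open-or-closed (k t m))

open-branch : ∀ {s} (t : Tableau s) → ¬ AllBranches Closed t → OpenTableau t
open-branch t ¬closed with open-or-closed t
... | inj₁ ¬closed = ¬closed
... | inj₂ closed = contradiction closed ¬closed

theorem1 : (φ : Formula) → Satisfiable φ → TableauSatisfiable φ
theorem1 φ (M , val , Vφ∈D) =
  0 , tableau , open-branch tableau (no-closed-tableau model tableau) , expanded
  where
  open Soundness M val using (root-model; no-closed-tableau)
  model = proj₂ (root-model Vφ∈D)
  expansion = expand (root 0 φ) (<-wellFounded _)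
  tableau = proj₁ expansion
  expanded = proj₂ expansion
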